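{- Let $\mathcal{K}$ be a field with a nontrivial nonarchimedean valuation, and let $B\in\mathcal{K}^{n\times n}$ be upper triangular such that the function $2^{[n]}\to\mathbb{R}$, $S\mapsto\nu(B(\{1,\dots,|S|\},S))$, is (well defined, i.e. real-valued, and) submodular. Then \[\nu(B(\{1,\dots,|S|\},S))\ \ge\ \nu(B(T,S))\] for all $S,T\subseteq[n]$ with $|S|=|T|$.
   Context: $\nu=-\mathrm{val}$ where $\mathrm{val}$ is the valuation, with $\nu(0)=-\infty$. $B(T,S)$ denotes the determinant of the submatrix of $B$ with rows $T$ and columns $S$ (the empty minor is $1$). A function $F:2^{[n]}\to\mathbb{R}$ is submodular if $F(S\cap T)+F(S\cup T)\le F(S)+F(T)$ for all $S,T\subseteq[n]$. -}

module Defs where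

open import Level using (0ℓ)
open import Data.Nat as ℕ using (ℕ)
open import Data.Fin using (Fin; zero; suc) renaming (_<_ to _<ᶠ_)
open import Data.Fin.Subset using (Subset; ∣_∣; _∩_; _∪_)
open import Data.Vec using ([]; _∷_)
open import Data.Bool using (true; false)
open import Data.List using (List; []; _∷_; map; take; allFin)
open import Data.Product using (Σ; ∃; _×_; _,_)
open import Data.Sum using (_⊎_)
open import Relation.Nullary using (¬_)
open import Relation.Binary.PropositionalEquality using (_≡_)
open import Relation.Binary.Structures using (IsTotalOrder)
open import Algebra.Structures using (IsCommutativeRing)

record Field : Set₁ where
  infixl 6 _+_
  infixl 7 _*_
  field
    Carrier : Set
    _+_ _*_ : Carrier → Carrier → Carrier
    -_      : Carrier → Carrier
    0# 1#   : Carrier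
    isCommutativeRing : IsCommutativeRing _≡_ _+_ _*_ -_ 0# 1#
    0≢1     : ¬ (0# ≡ 1#)
    inverse : ∀ x → ¬ (x ≡ 0#) → Σ Carrier (λ y → x * y ≡ 1#)

-- The real numbers, given axiomatically as a (Dedekind-)complete ordered
-- field (unique up to isomorphism, so quantifying over all such models
-- is the same as speaking about ℝ).

record RealField : Set₁ where
  field
    field′ : Field
  open Field field′ public
  infix 4 _≤_
  field
    _≤_         : Carrier → Carrier → Set
    isTotalOrder : IsTotalOrder _≡_ _≤_
    +-mono-≤    : ∀ {x y} z → x ≤ y → x + z ≤ y + z
    *-nonneg    : ∀ {x y} → 0# ≤ x → 0# ≤ y → 0# ≤ x * y
    complete    : (P : Carrier → Set) → Σ Carrier P →
                  Σ Carrier (λ b → ∀ x → P x → x ≤ b) →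
                  Σ Carrier (λ s → (∀ x → P x → x ≤ s) ×
                                   (∀ b → (∀ x → P x → x ≤ b) → s ≤ b))

-- Extended reals used for valuations: ℝ ∪ {+∞} (values of val) and
-- ℝ ∪ {-∞} (values of ν = -val).

data ℝ+∞ (R : RealField) : Set where
  fin : RealField.Carrier R → ℝ+∞ R
  ∞   : ℝ+∞ R

data ℝ-∞ (R : RealField) : Set where
  real : RealField.Carrier R → ℝ-∞ R
  -∞   : ℝ-∞ R

module _ {R : RealField} where
  open RealField R

  data _≤⁺_ : ℝ+∞ R → ℝ+∞ R → Set where
    fin≤fin : ∀ {a b} → a ≤ b → fin a ≤⁺ fin b
    _≤∞     : ∀ x → x ≤⁺ ∞

  _+⁺_ : ℝ+∞ R → ℝ+∞ R → ℝ+∞ R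
  fin a +⁺ fin b = fin (a + b)
  fin a +⁺ ∞     = ∞
  ∞     +⁺ _     = ∞

  data _≤⁻_ : ℝ-∞ R → ℝ-∞ R → Set where
    -∞≤      : ∀ x → -∞ ≤⁻ x
    real≤real : ∀ {a b} → a ≤ b → real a ≤⁻ real b

  neg : ℝ+∞ R → ℝ-∞ R
  neg (fin a) = real (- a)
  neg ∞       = -∞

record Valuation (K : Field) (R : RealField) : Set where
  open Field K
  field
    val       : Carrier → ℝ+∞ R
    val-∞     : ∀ x → val x ≡ ∞ → x ≡ 0#
    val-0     : val 0# ≡ ∞
    val-*     : ∀ x y → val (x * y) ≡ val x +⁺ val y
    val-nonarch : ∀ x y → (val x ≤⁺ val (x + y)) ⊎ (val y ≤⁺ val (x + y))
    nontrivial : Σ Carrier (λ x → ¬ (x ≡ 0#) × ¬ (val x ≡ fin (RealField.0# R)))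

  ν : Carrier → ℝ-∞ R
  ν x = neg (val x)

module _ (K : Field) where
  open Field K

  Matrix : ℕ → Set
  Matrix n = Fin n → Fin n → Carrier

  UpperTriangular : ∀ {n} → Matrix n → Set
  UpperTriangular {n} B = ∀ i j → j <ᶠ i → B i j ≡ 0#

  picks : ∀ {A : Set} → List A → List (Σ A (λ _ → List A))
  picks []       = []
  picks (x ∷ xs) = (x , xs) ∷ map (λ { (y , ys) → (y , x ∷ ys) }) (picks xs)

  -- det of the submatrix of B with row list rs and column list cs
  -- (Laplace expansion along the first row; equal lengths intended;
  --  the empty minor is 1)
  detL : ∀ {n} → Matrix n → List (Fin n) → List (Fin n) → Carrier
  detL B []       cs = 1#
  detL B (r ∷ rs) cs = expand 1# (picks cs)
    where
    expand : Carrier → List (Σ (Fin _) (λ _ → List (Fin _))) → Carrier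
    expand s []              = 0#
    expand s ((c , cs′) ∷ ps) = s * B r c * detL B rs cs′ + expand (- s) ps

  elems : ∀ {n} → Subset n → List (Fin n)
  elems []          = []
  elems (true ∷ S)  = zero ∷ map suc (elems S)
  elems (false ∷ S) = map suc (elems S)

  minor : ∀ {n} → Matrix n → Subset n → Subset n → Carrier
  minor B T S = detL B (elems T) (elems S)

  topMinor : ∀ {n} → Matrix n → Subset n → Carrier
  topMinor {n} B S = detL B (take ∣ S ∣ (allFin n)) (elems S)

Submodular : (R : RealField) → ∀ {n} → (Subset n → RealField.Carrier R) → Set
Submodular R F = ∀ S T → F (S ∩ T) + F (S ∪ T) ≤ F S + F T
  where open RealField R

-- Deleting the first row and column of B leaves an upper triangular B′ whose
-- top minors have valuations F′(X) = F({1} ∪ (X + 1)) − ν(B₁₁), because the first column of B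
-- vanishes below the diagonal; F′ is again submodular, and submodularity also gives
-- F′(X) ≤ F(X + 1). This settles every case except the one where T contains the first row and S
-- avoids the first column. That case is proved by induction on |T| and on the sum of the elements
-- of T. If T is not {1, …, |S|}, some row y₀ ≤ |S| is missing from T; the Plücker relation for the
-- rows T ∪ {y₀} and the columns S and S ∖ {s} writes B(T, S) times a cofactor of valuation exactly
-- F′(S ∖ {s}) as a signed sum of products bounded by the induction hypotheses and one more use of
-- submodularity, and the ultrametric inequality bounds the remaining term.

{-# OPTIONS --safe #-}
module Submission where

open import Level using (0ℓ)
open import Defs
open import Data.Nat as Nat using (ℕ; zero; suc)
import Data.Nat.Properties as ℕP
open import Data.Fin using (Fin; zero; suc; toℕ)
open import Data.Fin.Subset using (Subset; inside; outside; ∣_∣; _∈_; _∉_; _⊆_; _∩_; _∪_; ⊥; Nonempty)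
open import Data.Fin.Subset.Properties
  using (drop-there; drop-∷-⊆; out⊆; s⊆s; p⊆q⇒∣p∣≤∣q∣; ∣p∣≤n; ∣⊥∣≡0; ⊥⊆; _∈?_)
open import Data.Vec.Base using ([]; _∷_; here; there)
open import Data.Bool.Properties using (∧-zeroʳ; ∨-identityʳ)
open import Data.Sum as Sum using (_⊎_; inj₁; inj₂)
open import Relation.Nullary using (contradiction; yes; no)
open import Data.Nat.Induction using (<-rec)
open import Data.Integer as ℤ using (ℤ; -[1+_]; 0ℤ; 1ℤ)
open import Data.Sign as Sign using (Sign)
open import Data.Maybe as Maybe using (Maybe)
open import Relation.Nullary.Decidable using (dec⇒maybe)
open import Relation.Binary.PropositionalEquality
  using (_≡_; _≢_; ≢-sym; refl; sym; trans; cong; cong₂; subst; subst₂; module ≡-Reasoning)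
open import Function using (id; _∘_; flip)
open import Data.Product using (Σ; _×_; _,_; proj₁; proj₂; uncurry; ∃; ∃₂)
open import Data.List using (List; []; _∷_; [_]; _++_; map; length; take; allFin; tabulate)
open import Data.List.Relation.Unary.All as All using (All; []; _∷_)
open import Data.List.Relation.Unary.All.Properties using (map⁺; ++⁻ˡ; ++⁻ʳ)
open import Data.List.Relation.Binary.Subset.Propositional using () renaming (_⊆_ to _⊆ˡ_)
import Data.List.Relation.Binary.Subset.Propositional.Properties as ⊆ˡ
import Data.List.Relation.Unary.Any as Any
open import Data.List.Membership.Propositional using () renaming (_∈_ to _∈ˡ_)
open import Data.List.Membership.Propositional.Properties using (∈-∃++; ∈-map⁺)
open import Data.List.Properties using (map-++; ++-assoc; length-map; take-map; map-tabulate)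
open import Algebra.Bundles using (CommutativeRing)
open import Relation.Binary.Structures using (IsTotalOrder)
open import Algebra.Solver.Ring.AlmostCommutativeRing
  using (AlmostCommutativeRing; fromCommutativeRing; _-Raw-AlmostCommutative⟶_)

-- The ring solver needs coefficients with a decidable equality, so it is run with integer
-- coefficients, interpreted in F through the canonical homomorphism ℤ → F.
module FieldAlgebra (F : Field) where
  open Field F using (isCommutativeRing)

  commutativeRing : CommutativeRing 0ℓ 0ℓ
  commutativeRing = record { isCommutativeRing = isCommutativeRing }

  open CommutativeRing commutativeRing public hiding (refl; sym; trans; zero)
  open import Algebra.Properties.Ring ring public
    using (-0#≈0#; -‿involutive; -‿+-comm; -‿distribˡ-*; -‿distribʳ-*; -1*x≈-x; x+x≈x⇒x≈0; x∙y⁻¹≈ε⇒x≈y)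

  private
    open import Algebra.Properties.CommutativeSemigroup +-commutativeSemigroup using (interchange)
    open import Algebra.Properties.Semiring.Mult.TCOptimised semiring
      using (1+×; ×-homo-+; ×1-homo-*) renaming (_×_ to _·_)
    open ≡-Reasoning

    ⟦_⟧ : ℤ → Carrier
    ⟦ ℤ.+ n ⟧    = n · 1#
    ⟦ -[1+ n ] ⟧ = - (suc n · 1#)

    ⊖-homo : ∀ m n → ⟦ m ℤ.⊖ n ⟧ ≡ m · 1# - n · 1#
    ⊖-homo m       zero    = sym (trans (cong ((m · 1#) +_) -0#≈0#) (+-identityʳ _))
    ⊖-homo zero    (suc n) = sym (+-identityˡ _)
    ⊖-homo (suc m) (suc n) = begin
      ⟦ suc m ℤ.⊖ suc n ⟧         ≡⟨ cong ⟦_⟧ (ℤP.[1+m]⊖[1+n]≡m⊖n m n) ⟩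
      ⟦ m ℤ.⊖ n ⟧                 ≡⟨ ⊖-homo m n ⟩
      m · 1# - n · 1#             ≡⟨ +-identityˡ _ ⟨
      0# + (m · 1# - n · 1#)      ≡⟨ cong (_+ (m · 1# - n · 1#)) (-‿inverseʳ 1#) ⟨
      (1# - 1#) + (m · 1# - n · 1#) ≡⟨ interchange 1# (m · 1#) (- 1#) (- (n · 1#)) ⟨
      (1# + m · 1#) + (- 1# - n · 1#) ≡⟨ cong ((1# + m · 1#) +_) (-‿+-comm 1# (n · 1#)) ⟩
      (1# + m · 1#) - (1# + n · 1#) ≡⟨ cong₂ _-_ (1+× m 1#) (1+× n 1#) ⟨
      suc m · 1# - suc n · 1#     ∎
      where import Data.Integer.Properties as ℤP

    +-homo : ∀ i j → ⟦ i ℤ.+ j ⟧ ≡ ⟦ i ⟧ + ⟦ j ⟧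
    +-homo (ℤ.+ m)  (ℤ.+ n)  = ×-homo-+ 1# m n
    +-homo (ℤ.+ m)  -[1+ n ] = ⊖-homo m (suc n)
    +-homo -[1+ m ] (ℤ.+ n)  = trans (⊖-homo n (suc m)) (+-comm _ _)
    +-homo -[1+ m ] -[1+ n ] = begin
      - (suc (suc (m Nat.+ n)) · 1#)  ≡⟨ cong (λ k → - (k · 1#)) (ℕP.+-suc (suc m) n) ⟨
      - ((suc m Nat.+ suc n) · 1#)    ≡⟨ cong -_ (×-homo-+ 1# (suc m) (suc n)) ⟩
      - (suc m · 1# + suc n · 1#)     ≡⟨ -‿+-comm _ _ ⟨
      - (suc m · 1#) - suc n · 1#     ∎

    -‿homo : ∀ i → ⟦ ℤ.- i ⟧ ≡ - ⟦ i ⟧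
    -‿homo (ℤ.+ zero)  = sym -0#≈0#
    -‿homo (ℤ.+ suc n) = refl
    -‿homo -[1+ n ]    = sym (-‿involutive _)

    signed : Sign → Carrier → Carrier
    signed Sign.+ x = x
    signed Sign.- x = - x

    signed-* : ∀ s t x y → signed (s Sign.* t) (x * y) ≡ signed s x * signed t y
    signed-* Sign.+ Sign.+ x y = refl
    signed-* Sign.+ Sign.- x y = -‿distribʳ-* x y
    signed-* Sign.- Sign.+ x y = -‿distribˡ-* x y
    signed-* Sign.- Sign.- x y = begin
      x * y         ≡⟨ -‿involutive _ ⟨
      - - (x * y)   ≡⟨ cong -_ (-‿distribˡ-* x y) ⟩
      - (- x * y)   ≡⟨ -‿distribʳ-* (- x) y ⟩
      - x * - y     ∎

    ◃-homo : ∀ s n → ⟦ s ℤ.◃ n ⟧ ≡ signed s (n · 1#)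
    ◃-homo Sign.+ zero    = refl
    ◃-homo Sign.- zero    = sym -0#≈0#
    ◃-homo Sign.+ (suc n) = refl
    ◃-homo Sign.- (suc n) = refl

    ⟦⟧-signed : ∀ i → ⟦ i ⟧ ≡ signed (ℤ.sign i) (ℤ.∣ i ∣ · 1#)
    ⟦⟧-signed (ℤ.+ n)  = refl
    ⟦⟧-signed -[1+ n ] = refl

    *-homo : ∀ i j → ⟦ i ℤ.* j ⟧ ≡ ⟦ i ⟧ * ⟦ j ⟧
    *-homo i j = begin
      ⟦ (s Sign.* t) ℤ.◃ (m Nat.* n) ⟧          ≡⟨ ◃-homo (s Sign.* t) (m Nat.* n) ⟩
      signed (s Sign.* t) ((m Nat.* n) · 1#)    ≡⟨ cong (signed (s Sign.* t)) (×1-homo-* m n) ⟩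
      signed (s Sign.* t) ((m · 1#) * (n · 1#)) ≡⟨ signed-* s t _ _ ⟩
      signed s (m · 1#) * signed t (n · 1#)     ≡⟨ cong₂ _*_ (⟦⟧-signed i) (⟦⟧-signed j) ⟨
      ⟦ i ⟧ * ⟦ j ⟧                             ∎
      where
      s = ℤ.sign i
      t = ℤ.sign j
      m = ℤ.∣ i ∣
      n = ℤ.∣ j ∣

    almostCommutativeRing : AlmostCommutativeRing 0ℓ 0ℓ
    almostCommutativeRing = fromCommutativeRing commutativeRing

    ℤ-homomorphism : ℤ.+-*-rawRing -Raw-AlmostCommutative⟶ almostCommutativeRing
    ℤ-homomorphism = record
      { ⟦_⟧ = ⟦_⟧ ; +-homo = +-homo ; *-homo = *-homo ; -‿homo = -‿homo
      ; 0-homo = refl ; 1-homo = refl }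

  open import Algebra.Solver.Ring ℤ.+-*-rawRing almostCommutativeRing ℤ-homomorphism
    (λ i j → Maybe.map (cong ⟦_⟧) (dec⇒maybe (i ℤ.≟ j))) public
    using (solve; _:=_; _:+_; _:-_; _:*_; :-_; con)

module AlternatingSums (K : Field) where
  open FieldAlgebra K
  open ≡-Reasoning

  private variable
    A B : Set

  sign : ℕ → Carrier
  sign zero    = 1#
  sign (suc k) = - sign k

  altSum : List A → (A → Carrier) → Carrier
  altSum []       f = 0#
  altSum (x ∷ xs) f = f x - altSum xs f

  altSum-cong : ∀ (xs : List A) {f g} → (∀ x → f x ≡ g x) → altSum xs f ≡ altSum xs g
  altSum-cong []       f≗g = refl
  altSum-cong (x ∷ xs) f≗g = cong₂ _-_ (f≗g x) (altSum-cong xs f≗g)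

  altSum-zero : ∀ {xs : List A} {f} → All (λ x → f x ≡ 0#) xs → altSum xs f ≡ 0#
  altSum-zero []       = refl
  altSum-zero (e ∷ es) = trans (cong₂ _-_ e (altSum-zero es)) (-‿inverseʳ 0#)

  altSum-map : ∀ (h : A → B) xs f → altSum (map h xs) f ≡ altSum xs (f ∘ h)
  altSum-map h []       f = refl
  altSum-map h (x ∷ xs) f = cong (_-_ (f (h x))) (altSum-map h xs f)

  altSum-neg : ∀ (xs : List A) f → altSum xs (λ x → - f x) ≡ - altSum xs f
  altSum-neg []       f = sym -0#≈0#
  altSum-neg (x ∷ xs) f = trans (cong (_-_ (- f x)) (altSum-neg xs f))
    (solve 2 (λ a b → :- a :- :- b := :- (a :- b)) refl (f x) _)

  altSum-negate : ∀ (xs : List A) {f g} → (∀ x → f x ≡ - g x) → altSum xs f ≡ - altSum xs g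
  altSum-negate xs {g = g} f≡-g = trans (altSum-cong xs f≡-g) (altSum-neg xs g)

  altSum-+ : ∀ (xs : List A) f g → altSum xs (λ x → f x + g x) ≡ altSum xs f + altSum xs g
  altSum-+ []       f g = sym (+-identityʳ 0#)
  altSum-+ (x ∷ xs) f g = trans (cong (_-_ (f x + g x)) (altSum-+ xs f g))
    (solve 4 (λ a b c d → (a :+ b) :- (c :+ d) := (a :- c) :+ (b :- d)) refl (f x) (g x) _ _)

  altSum-*ˡ : ∀ c (xs : List A) f → altSum xs (λ x → c * f x) ≡ c * altSum xs f
  altSum-*ˡ c []       f = sym (zeroʳ c)
  altSum-*ˡ c (x ∷ xs) f = trans (cong (_-_ (c * f x)) (altSum-*ˡ c xs f))
    (solve 3 (λ c a b → c :* a :- c :* b := c :* (a :- b)) refl c (f x) _)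

  altSum-swap : ∀ (xs : List A) (ys : List B) (G : A → B → Carrier) →
    altSum xs (λ x → altSum ys (G x)) ≡ altSum ys (λ y → altSum xs (λ x → G x y))
  altSum-swap []       ys G = sym (altSum-zero (All.universal (λ _ → refl) ys))
  altSum-swap (x ∷ xs) ys G = begin
    altSum ys (G x) - altSum xs (λ x′ → altSum ys (G x′))
      ≡⟨ cong (_-_ (altSum ys (G x))) (altSum-swap xs ys G) ⟩
    altSum ys (G x) - altSum ys (λ y → altSum xs (λ x′ → G x′ y))
      ≡⟨ cong (altSum ys (G x) +_) (sym (altSum-neg ys _)) ⟩
    altSum ys (G x) + altSum ys (λ y → - altSum xs (λ x′ → G x′ y))
      ≡⟨ sym (altSum-+ ys (G x) _) ⟩
    altSum ys (λ y → G x y - altSum xs (λ x′ → G x′ y)) ∎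

  altSum-interchange : ∀ (xs : List A) (ys : List B)
    (a : A → Carrier) (b : B → Carrier) (E : A → B → Carrier) →
    altSum xs (λ x → a x * altSum ys (λ y → b y * E x y)) ≡
    altSum ys (λ y → b y * altSum xs (λ x → a x * E x y))
  altSum-interchange xs ys a b E = begin
    altSum xs (λ x → a x * altSum ys (λ y → b y * E x y))
      ≡⟨ altSum-cong xs (λ x → sym (altSum-*ˡ (a x) ys (λ y → b y * E x y))) ⟩
    altSum xs (λ x → altSum ys (λ y → a x * (b y * E x y)))
      ≡⟨ altSum-swap xs ys (λ x y → a x * (b y * E x y)) ⟩
    altSum ys (λ y → altSum xs (λ x → a x * (b y * E x y)))
      ≡⟨ altSum-cong ys (λ y → trans
           (altSum-cong xs (λ x → solve 3 (λ a b e → a :* (b :* e) := b :* (a :* e)) refl _ _ _))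
           (altSum-*ˡ (b y) xs (λ x → a x * E x y))) ⟩
    altSum ys (λ y → b y * altSum xs (λ x → a x * E x y)) ∎

  altSum-++ : ∀ (xs ys : List A) f → altSum (xs ++ ys) f ≡ altSum xs f + sign (length xs) * altSum ys f
  altSum-++ []       ys f = solve 1 (λ a → a := con 0ℤ :+ con 1ℤ :* a) refl (altSum ys f)
  altSum-++ (x ∷ xs) ys f = trans (cong (_-_ (f x)) (altSum-++ xs ys f))
    (solve 4 (λ a b s c → a :- (b :+ s :* c) := (a :- b) :+ (:- s) :* c) refl (f x) _ (sign (length xs)) _)

  altSum-picks-map : ∀ (h : A → B) xs (g : B × List B → Carrier) →
    altSum (picks K (map h xs)) g ≡ altSum (picks K xs) (uncurry λ x r → g (h x , map h r))
  altSum-picks-map h []       g = refl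
  altSum-picks-map h (x ∷ xs) g = cong (_-_ (g (h x , map h xs)))
    (trans (altSum-map _ (picks K (map h xs)) g)
    (trans (altSum-picks-map h xs _)
           (sym (altSum-map _ (picks K xs) _))))

  altSum-picks-++ : ∀ (xs ys : List A) g →
    altSum (picks K (xs ++ ys)) g ≡
    altSum (picks K xs) (uncurry λ x r → g (x , r ++ ys)) +
    sign (length xs) * altSum (picks K ys) (uncurry λ y r → g (y , xs ++ r))
  altSum-picks-++ []       ys g = solve 1 (λ a → a := con 0ℤ :+ con 1ℤ :* a) refl _
  altSum-picks-++ (x ∷ xs) ys g = begin
    altSum (picks K (x ∷ xs ++ ys)) g
      ≡⟨ cong (_-_ (g (x , xs ++ ys))) (altSum-map _ (picks K (xs ++ ys)) g) ⟩
    g (x , xs ++ ys) - altSum (picks K (xs ++ ys)) (λ p → g (proj₁ p , x ∷ proj₂ p))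
      ≡⟨ cong (_-_ (g (x , xs ++ ys))) (altSum-picks-++ xs ys _) ⟩
    g (x , xs ++ ys) - (a + σ * b)
      ≡⟨ solve 4 (λ g a s b → g :- (a :+ s :* b) := (g :- a) :+ (:- s) :* b) refl _ a σ b ⟩
    (g (x , xs ++ ys) - a) + - σ * b
      ≡⟨ cong (λ z → (g (x , xs ++ ys) - z) + - σ * b) (sym (altSum-map _ (picks K xs) _)) ⟩
    altSum (picks K (x ∷ xs)) (uncurry λ x′ r → g (x′ , r ++ ys)) + sign (length (x ∷ xs)) * b ∎
    where
    σ = sign (length xs)
    a = altSum (picks K xs) (uncurry λ x′ r → g (x′ , x ∷ r ++ ys))
    b = altSum (picks K ys) (uncurry λ y r → g (y , x ∷ xs ++ r))

  picks-∈ : ∀ (xs : List A) → All (λ p → proj₁ p ∈ˡ xs) (picks K xs)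
  picks-∈ []       = []
  picks-∈ (x ∷ xs) = Any.here refl ∷ map⁺ (All.map Any.there (picks-∈ xs))

  picks-length : ∀ (xs : List A) → All (λ p → suc (length (proj₂ p)) ≡ length xs) (picks K xs)
  picks-length []       = []
  picks-length (x ∷ xs) = refl ∷ map⁺ (All.map (cong suc) (picks-length xs))

module Determinants (K : Field) where
  open FieldAlgebra K
  open AlternatingSums K
  open ≡-Reasoning

  private variable
    R C : Set

  det : (R → C → Carrier) → List R → List C → Carrier
  det M []       []      = 1#
  det M []       (_ ∷ _) = 0#
  det M (r ∷ rs) cs      = altSum (picks K cs) (uncurry λ c cs′ → M r c * det M rs cs′)

  det-map : ∀ {R′ C′ : Set} (M : R → C → Carrier) (f : R′ → R) (g : C′ → C) rs cs →
    det M (map f rs) (map g cs) ≡ det (λ i j → M (f i) (g j)) rs cs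
  det-map M f g []       []       = refl
  det-map M f g []       (c ∷ cs) = refl
  det-map M f g (r ∷ rs) cs       = trans (altSum-picks-map g cs _)
    (altSum-cong (picks K cs) (λ p → cong (M (f r) (g (proj₁ p)) *_) (det-map M f g rs (proj₂ p))))

  det-[]-++ : ∀ (M : R → C → Carrier) A c Cs → det M [] (A ++ c ∷ Cs) ≡ 0#
  det-[]-++ M []      c Cs = refl
  det-[]-++ M (_ ∷ A) c Cs = refl

  det-expand-adjacent : ∀ (M : R → C → Carrier) r rs A a b Cs →
    det M (r ∷ rs) (A ++ a ∷ b ∷ Cs) ≡
    altSum (picks K A) (uncurry λ c A′ → M r c * det M rs (A′ ++ a ∷ b ∷ Cs)) +
    sign (length A) * (M r a * det M rs (A ++ b ∷ Cs) - (M r b * det M rs (A ++ a ∷ Cs) -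
      altSum (picks K Cs) (uncurry λ c Cs′ → M r c * det M rs (A ++ a ∷ b ∷ Cs′))))
  det-expand-adjacent M r rs A a b Cs = trans (altSum-picks-++ A (a ∷ b ∷ Cs) _)
    (cong (λ z → X + sign (length A) * (M r a * det M rs (A ++ b ∷ Cs) - (M r b * det M rs (A ++ a ∷ Cs) - z)))
          (trans (altSum-map _ (map _ (picks K Cs)) _) (altSum-map _ (picks K Cs) _)))
    where X = altSum (picks K A) (uncurry λ c A′ → M r c * det M rs (A′ ++ a ∷ b ∷ Cs))

  det-swapAdjacent : ∀ (M : R → C → Carrier) rs A a b Cs →
    det M rs (A ++ a ∷ b ∷ Cs) ≡ - det M rs (A ++ b ∷ a ∷ Cs)
  det-swapAdjacent M []       A a b Cs =
    trans (det-[]-++ M A a _) (sym (trans (cong -_ (det-[]-++ M A b _)) -0#≈0#))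
  det-swapAdjacent M (r ∷ rs) A a b Cs = begin
    det M (r ∷ rs) (A ++ a ∷ b ∷ Cs)       ≡⟨ det-expand-adjacent M r rs A a b Cs ⟩
    X a b + σ * (u - (v - W a b))          ≡⟨ cong₂ (λ x w → x + σ * (u - (v - w))) X-swap W-swap ⟩
    - X b a + σ * (u - (v - - W b a))
      ≡⟨ solve 5 (λ x s u v w → :- x :+ s :* (u :- (v :- :- w)) := :- (x :+ s :* (v :- (u :- w))))
               refl (X b a) σ u v (W b a) ⟩
    - (X b a + σ * (v - (u - W b a)))      ≡⟨ cong -_ (sym (det-expand-adjacent M r rs A b a Cs)) ⟩
    - det M (r ∷ rs) (A ++ b ∷ a ∷ Cs)     ∎
    where
    σ = sign (length A)
    u = M r a * det M rs (A ++ b ∷ Cs)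
    v = M r b * det M rs (A ++ a ∷ Cs)
    X W : _ → _ → Carrier
    X a b = altSum (picks K A) (uncurry λ c A′ → M r c * det M rs (A′ ++ a ∷ b ∷ Cs))
    W a b = altSum (picks K Cs) (uncurry λ c Cs′ → M r c * det M rs (A ++ a ∷ b ∷ Cs′))
    X-swap : X a b ≡ - X b a
    X-swap = altSum-negate (picks K A) λ p →
      trans (cong (M r (proj₁ p) *_) (det-swapAdjacent M rs (proj₂ p) a b Cs)) (sym (-‿distribʳ-* _ _))
    W-swap : W a b ≡ - W b a
    W-swap = altSum-negate (picks K Cs) λ p →
      trans (cong (M r (proj₁ p) *_) (det-swapAdjacent M rs A a b (proj₂ p))) (sym (-‿distribʳ-* _ _))

  det-repeatedAdjacent : ∀ (M : R → C → Carrier) rs A a Cs → det M rs (A ++ a ∷ a ∷ Cs) ≡ 0#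
  det-repeatedAdjacent M []       A a Cs = det-[]-++ M A a _
  det-repeatedAdjacent M (r ∷ rs) A a Cs = begin
    det M (r ∷ rs) (A ++ a ∷ a ∷ Cs)   ≡⟨ det-expand-adjacent M r rs A a a Cs ⟩
    X + σ * (u - (u - W))              ≡⟨ cong₂ (λ x w → x + σ * (u - (u - w))) X≡0 W≡0 ⟩
    0# + σ * (u - (u - 0#))            ≡⟨ solve 2 (λ s u → con 0ℤ :+ s :* (u :- (u :- con 0ℤ)) := con 0ℤ)
                                                   refl σ u ⟩
    0#                                 ∎
    where
    σ = sign (length A)
    u = M r a * det M rs (A ++ a ∷ Cs)
    X = altSum (picks K A) (uncurry λ c A′ → M r c * det M rs (A′ ++ a ∷ a ∷ Cs))
    W = altSum (picks K Cs) (uncurry λ c Cs′ → M r c * det M rs (A ++ a ∷ a ∷ Cs′))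
    X≡0 : X ≡ 0#
    X≡0 = altSum-zero (All.universal (λ p →
      trans (cong (M r (proj₁ p) *_) (det-repeatedAdjacent M rs (proj₂ p) a Cs)) (zeroʳ _)) (picks K A))
    W≡0 : W ≡ 0#
    W≡0 = altSum-zero (All.universal (λ p →
      trans (cong (M r (proj₁ p) *_) (det-repeatedAdjacent M rs A a (proj₂ p))) (zeroʳ _)) (picks K Cs))

  det-moveColumn : ∀ (M : R → C → Carrier) rs P A x Cs →
    det M rs (P ++ A ++ x ∷ Cs) ≡ sign (length A) * det M rs (P ++ x ∷ A ++ Cs)
  det-moveColumn M rs P []      x Cs = sym (*-identityˡ _)
  det-moveColumn M rs P (a ∷ A) x Cs = begin
    det M rs (P ++ a ∷ A ++ x ∷ Cs)                ≡⟨ cong (det M rs) (sym (++-assoc P [ a ] _)) ⟩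
    det M rs ((P ++ [ a ]) ++ A ++ x ∷ Cs)         ≡⟨ det-moveColumn M rs (P ++ [ a ]) A x Cs ⟩
    σ * det M rs ((P ++ [ a ]) ++ x ∷ A ++ Cs)     ≡⟨ cong (λ cs → σ * det M rs cs) (++-assoc P [ a ] _) ⟩
    σ * det M rs (P ++ a ∷ x ∷ A ++ Cs)            ≡⟨ cong (σ *_) (det-swapAdjacent M rs P a x (A ++ Cs)) ⟩
    σ * - det M rs (P ++ x ∷ a ∷ A ++ Cs)          ≡⟨ sym (-‿distribʳ-* σ _) ⟩
    - (σ * det M rs (P ++ x ∷ a ∷ A ++ Cs))        ≡⟨ -‿distribˡ-* σ _ ⟩
    - σ * det M rs (P ++ x ∷ a ∷ A ++ Cs)          ∎
    where σ = sign (length A)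

  det-repeatedColumn : ∀ (M : R → C → Carrier) rs {x cs} → x ∈ˡ cs → det M rs (x ∷ cs) ≡ 0#
  det-repeatedColumn M rs {x} x∈cs with ∈-∃++ x∈cs
  ... | A , Cs , refl = begin
    det M rs (x ∷ A ++ x ∷ Cs)                     ≡⟨ det-moveColumn M rs [ x ] A x Cs ⟩
    sign (length A) * det M rs (x ∷ x ∷ A ++ Cs)   ≡⟨ cong (sign (length A) *_)
                                                           (det-repeatedAdjacent M rs [] x (A ++ Cs)) ⟩
    sign (length A) * 0#                           ≡⟨ zeroʳ _ ⟩
    0#                                             ∎

  det-expandColumn : ∀ (M : R → C → Carrier) rs c cs →
    det M rs (c ∷ cs) ≡ altSum (picks K rs) (uncurry λ r rs′ → M r c * det M rs′ cs)
  det-expandColumn M []            c cs = refl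
  det-expandColumn M (r ∷ [])      c cs = cong (_-_ (M r c * det M [] cs))
    (trans (altSum-map _ (picks K cs) _) (altSum-zero (All.universal (λ _ → zeroʳ _) (picks K cs))))
  det-expandColumn M (r ∷ r′ ∷ rs) c cs = cong (_-_ (M r c * det M (r′ ∷ rs) cs)) (begin
    altSum (map _ (picks K cs)) (uncurry λ c′ cs′ → M r c′ * det M (r′ ∷ rs) cs′)
      ≡⟨ altSum-map _ (picks K cs) _ ⟩
    altSum (picks K cs) (λ p → M r (proj₁ p) * det M (r′ ∷ rs) (c ∷ proj₂ p))
      ≡⟨ altSum-cong (picks K cs) (λ p → cong (M r (proj₁ p) *_)
           (det-expandColumn M (r′ ∷ rs) c (proj₂ p))) ⟩
    altSum (picks K cs) (λ p → M r (proj₁ p) *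
      altSum (picks K (r′ ∷ rs)) (λ q → M (proj₁ q) c * det M (proj₂ q) (proj₂ p)))
      ≡⟨ altSum-interchange (picks K cs) (picks K (r′ ∷ rs)) _ _ _ ⟩
    altSum (picks K (r′ ∷ rs)) (λ q → M (proj₁ q) c * det M (r ∷ proj₂ q) cs)
      ≡⟨ sym (altSum-map _ (picks K (r′ ∷ rs)) _) ⟩
    altSum (map _ (picks K (r′ ∷ rs))) (uncurry λ r″ rs′ → M r″ c * det M rs′ cs) ∎)

  det-transpose : ∀ (M : R → C → Carrier) rs cs → det M rs cs ≡ det (flip M) cs rs
  det-transpose M []       []       = refl
  det-transpose M []       (c ∷ cs) = refl
  det-transpose M (r ∷ rs) []       = refl
  det-transpose M (r ∷ rs) (c ∷ cs) = trans (det-expandColumn M (r ∷ rs) c cs)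
    (altSum-cong (picks K (r ∷ rs)) (λ p → cong (M (proj₁ p) c *_) (det-transpose M (proj₂ p) cs)))

  det-repeatedRow : ∀ (M : R → C → Carrier) {x rs} cs → x ∈ˡ rs → det M (x ∷ rs) cs ≡ 0#
  det-repeatedRow M {x} {rs} cs x∈rs =
    trans (det-transpose M (x ∷ rs) cs) (det-repeatedColumn (flip M) cs x∈rs)

  det-moveRow : ∀ (M : R → C → Carrier) A x Rs cs →
    det M (A ++ x ∷ Rs) cs ≡ sign (length A) * det M (x ∷ A ++ Rs) cs
  det-moveRow M A x Rs cs = begin
    det M (A ++ x ∷ Rs) cs                           ≡⟨ det-transpose M _ cs ⟩
    det (flip M) cs (A ++ x ∷ Rs)                    ≡⟨ det-moveColumn (flip M) cs [] A x Rs ⟩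
    sign (length A) * det (flip M) cs (x ∷ A ++ Rs)  ≡⟨ cong (sign (length A) *_) (det-transpose M _ cs) ⟨
    sign (length A) * det M (x ∷ A ++ Rs) cs         ∎

  det-plücker : ∀ (M : R → C → Carrier) is js (cs′ cs : List C) → (∀ {c} → c ∈ˡ cs′ → c ∈ˡ cs) →
    altSum (picks K js) (uncurry λ j js′ → det M (j ∷ is) cs′ * det M js′ cs) ≡ 0#
  det-plücker M is js cs′ cs cs′⊆cs = begin
    altSum (picks K js) (uncurry λ j js′ → det M (j ∷ is) cs′ * det M js′ cs)
      ≡⟨ altSum-cong (picks K js) (λ q → trans (*-comm _ _) (cong (det M (proj₂ q) cs *_)
           (altSum-cong (picks K cs′) (λ p → *-comm _ _)))) ⟩
    altSum (picks K js) (λ q → det M (proj₂ q) cs *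
      altSum (picks K cs′) (λ p → det M is (proj₂ p) * M (proj₁ q) (proj₁ p)))
      ≡⟨ altSum-interchange (picks K js) (picks K cs′) _ _ _ ⟩
    altSum (picks K cs′) (λ p → det M is (proj₂ p) *
      altSum (picks K js) (λ q → det M (proj₂ q) cs * M (proj₁ q) (proj₁ p)))
      ≡⟨ altSum-zero (All.map (λ {p} p∈cs′ →
           trans (cong (det M is (proj₂ p) *_) (vanishes (proj₁ p) (cs′⊆cs p∈cs′))) (zeroʳ _)) (picks-∈ cs′)) ⟩
    0# ∎
    where
    vanishes : ∀ c → c ∈ˡ cs → altSum (picks K js) (λ q → det M (proj₂ q) cs * M (proj₁ q) c) ≡ 0#
    vanishes c c∈cs = begin
      altSum (picks K js) (λ q → det M (proj₂ q) cs * M (proj₁ q) c)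
        ≡⟨ altSum-cong (picks K js) (λ q → *-comm _ _) ⟩
      altSum (picks K js) (λ q → M (proj₁ q) c * det M (proj₂ q) cs)
        ≡⟨ sym (det-expandColumn M js c cs) ⟩
      det M js (c ∷ cs)
        ≡⟨ det-repeatedColumn M js c∈cs ⟩
      0# ∎

  -- `detL` expands along its first row through a local function that cannot be named, so
  -- `expandᴸ` is left as a metavariable and gets solved by unification in `detL-∷`.
  private mutual
    expandᴸ : ∀ {n} → Matrix K n → Fin n → List (Fin n) → List (Fin n) →
              Carrier → List (Fin n × List (Fin n)) → Carrier
    expandᴸ B r rs cs = _

    detL-∷ : ∀ {n} (B : Matrix K n) r rs cs →
      detL K B (r ∷ rs) cs ≡ expandᴸ B r rs cs 1# (picks K cs)
    detL-∷ B r rs cs with picks K cs | 1#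
    ... | ps | s = refl

  private

    expandᴸ≡altSum : ∀ {n} (B : Matrix K n) r rs cs s ps →
      All (λ p → detL K B rs (proj₂ p) ≡ det B rs (proj₂ p)) ps →
      expandᴸ B r rs cs s ps ≡ s * altSum ps (uncurry λ c cs′ → B r c * det B rs cs′)
    expandᴸ≡altSum B r rs cs s []               []       = sym (zeroʳ s)
    expandᴸ≡altSum B r rs cs s ((c , cs′) ∷ ps) (e ∷ es) = begin
      s * B r c * detL K B rs cs′ + expandᴸ B r rs cs (- s) ps
        ≡⟨ cong₂ (λ d x → s * B r c * d + x) e (expandᴸ≡altSum B r rs cs (- s) ps es) ⟩
      s * B r c * det B rs cs′ + - s * altSum ps _
        ≡⟨ solve 4 (λ s b d a → s :* b :* d :+ (:- s) :* a := s :* (b :* d :- a)) refl s _ _ _ ⟩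
      s * (B r c * det B rs cs′ - altSum ps (uncurry λ c cs′ → B r c * det B rs cs′)) ∎

  detL≡det : ∀ {n} (B : Matrix K n) rs cs → length rs ≡ length cs → detL K B rs cs ≡ det B rs cs
  detL≡det B []       []      _ = refl
  detL≡det B (r ∷ rs) cs      e = begin
    detL K B (r ∷ rs) cs
      ≡⟨ detL-∷ B r rs cs ⟩
    expandᴸ B r rs cs 1# (picks K cs)
      ≡⟨ expandᴸ≡altSum B r rs cs 1# (picks K cs)
           (All.map (λ {p} ∣p∣ → detL≡det B rs (proj₂ p) (ℕP.suc-injective (trans e (sym ∣p∣))))
                    (picks-length cs)) ⟩
    1# * det B (r ∷ rs) cs
      ≡⟨ *-identityˡ _ ⟩
    det B (r ∷ rs) cs ∎

module FinSubsets where
  open Nat using (_<_; _≤_; _+_; z≤n; s≤s)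

  private variable
    n : ℕ
    p q : Subset n
    x y : Fin n

  insert : Subset n → Fin n → Subset n
  insert (_ ∷ p) zero    = inside ∷ p
  insert (b ∷ p) (suc y) = b ∷ insert p y

  remove : Subset n → Fin n → Subset n
  remove (_ ∷ p) zero    = outside ∷ p
  remove (b ∷ p) (suc y) = b ∷ remove p y

  -- the sum of the elements of p
  weight : Subset n → ℕ
  weight []      = 0
  weight (_ ∷ p) = ∣ p ∣ + weight p

  initial : ∀ n → ℕ → Subset n
  initial zero    j       = []
  initial (suc n) zero    = outside ∷ initial n zero
  initial (suc n) (suc j) = inside ∷ initial n j

  ∈-insert⁺ : ∀ y → x ∈ p → x ∈ insert p y
  ∈-insert⁺ zero    here        = here
  ∈-insert⁺ (suc y) here        = here
  ∈-insert⁺ zero    (there x∈p) = there x∈p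
  ∈-insert⁺ (suc y) (there x∈p) = there (∈-insert⁺ y x∈p)

  ∈-remove⁺ : x ∈ p → x ≢ y → x ∈ remove p y
  ∈-remove⁺ {y = zero}  here        x≢y = contradiction refl x≢y
  ∈-remove⁺ {y = suc y} here        x≢y = here
  ∈-remove⁺ {y = zero}  (there x∈p) x≢y = there x∈p
  ∈-remove⁺ {y = suc y} (there x∈p) x≢y = there (∈-remove⁺ x∈p (x≢y ∘ cong suc))

  y∉remove : ∀ (p : Subset n) y → y ∉ remove p y
  y∉remove (_ ∷ p) (suc y) (there y∈p) = y∉remove p y y∈p

  remove-⊆ : ∀ (p : Subset n) y → remove p y ⊆ p
  remove-⊆ (_ ∷ p) zero    (there x∈p) = there x∈p
  remove-⊆ (_ ∷ p) (suc y) here        = here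
  remove-⊆ (_ ∷ p) (suc y) (there x∈p) = there (remove-⊆ p y x∈p)

  ∣insert∣ : ∀ (p : Subset n) y → y ∉ p → ∣ insert p y ∣ ≡ suc ∣ p ∣
  ∣insert∣ (outside ∷ p) zero    _   = refl
  ∣insert∣ (inside ∷ p)  zero    y∉p = contradiction here y∉p
  ∣insert∣ (outside ∷ p) (suc y) y∉p = ∣insert∣ p y (y∉p ∘ there)
  ∣insert∣ (inside ∷ p)  (suc y) y∉p = cong suc (∣insert∣ p y (y∉p ∘ there))

  ∣remove∣ : y ∈ p → suc ∣ remove p y ∣ ≡ ∣ p ∣
  ∣remove∣                     here        = refl
  ∣remove∣ {p = outside ∷ _} (there y∈p) = ∣remove∣ y∈p
  ∣remove∣ {p = inside ∷ _}  (there y∈p) = cong suc (∣remove∣ y∈p)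

  insert-remove : y ∈ p → insert (remove p y) y ≡ p
  insert-remove               here        = refl
  insert-remove {p = b ∷ _} (there y∈p) = cong (b ∷_) (insert-remove y∈p)

  remove-insert : ∀ (p : Subset n) y → y ∉ p → remove (insert p y) y ≡ p
  remove-insert (outside ∷ p) zero    _   = refl
  remove-insert (inside ∷ p)  zero    y∉p = contradiction here y∉p
  remove-insert (b ∷ p)       (suc y) y∉p = cong (b ∷_) (remove-insert p y (y∉p ∘ there))

  weight-insert : ∀ (p : Subset n) y → y ∉ p → weight (insert p y) ≡ weight p + toℕ y
  weight-insert (outside ∷ p) zero    _   = sym (ℕP.+-identityʳ _)
  weight-insert (inside ∷ p)  zero    y∉p = contradiction here y∉p
  weight-insert (b ∷ p)       (suc y) y∉p = begin
    ∣ insert p y ∣ + weight (insert p y)   ≡⟨ cong₂ _+_ (∣insert∣ p y y∉p′) (weight-insert p y y∉p′) ⟩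
    suc ∣ p ∣ + (weight p + toℕ y)         ≡⟨ cong suc (sym (ℕP.+-assoc ∣ p ∣ (weight p) (toℕ y))) ⟩
    suc (∣ p ∣ + weight p + toℕ y)         ≡⟨ sym (ℕP.+-suc _ _) ⟩
    ∣ p ∣ + weight p + suc (toℕ y)         ∎
    where
    open ≡-Reasoning
    y∉p′ = y∉p ∘ there

  weight-remove : y ∈ p → weight (remove p y) + toℕ y ≡ weight p
  weight-remove               here                = ℕP.+-identityʳ _
  weight-remove {y = suc y} {p = _ ∷ p} (there y∈p) = begin
    ∣ remove p y ∣ + weight (remove p y) + suc (toℕ y)   ≡⟨ ℕP.+-suc _ _ ⟩
    suc (∣ remove p y ∣ + weight (remove p y) + toℕ y)   ≡⟨ cong suc (ℕP.+-assoc ∣ remove p y ∣ _ _) ⟩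
    suc ∣ remove p y ∣ + (weight (remove p y) + toℕ y)   ≡⟨ cong₂ _+_ (∣remove∣ y∈p) (weight-remove y∈p) ⟩
    ∣ p ∣ + weight p                                     ∎
    where open ≡-Reasoning

  weight-exchange : ∀ (p : Subset n) {x y} → x ∉ p → y ∈ p → toℕ x < toℕ y →
    weight (remove (insert p x) y) < weight p
  weight-exchange p {x} {y} x∉p y∈p x<y = ℕP.+-cancelʳ-< (toℕ y) _ _ (begin-strict
    weight (remove (insert p x) y) + toℕ y   ≡⟨ weight-remove (∈-insert⁺ x y∈p) ⟩
    weight (insert p x)                      ≡⟨ weight-insert p x x∉p ⟩
    weight p + toℕ x                         <⟨ ℕP.+-monoʳ-< (weight p) x<y ⟩
    weight p + toℕ y                         ∎)
    where open ℕP.≤-Reasoning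

  ∈-initial⁺ : ∀ {n j} {i : Fin n} → toℕ i < j → i ∈ initial n j
  ∈-initial⁺ {suc n} {suc j} {zero}  _         = here
  ∈-initial⁺ {suc n} {suc j} {suc i} (s≤s i<j) = there (∈-initial⁺ i<j)

  ∈-initial⁻ : ∀ {n j} {i : Fin n} → i ∈ initial n j → toℕ i < j
  ∈-initial⁻ {suc n} {suc j} here        = s≤s z≤n
  ∈-initial⁻ {suc n} {zero}  (there i∈)  = contradiction (∈-initial⁻ i∈) ℕP.n≮0
  ∈-initial⁻ {suc n} {suc j} (there i∈)  = s≤s (∈-initial⁻ i∈)

  ∣initial∣ : ∀ {n j} → j ≤ n → ∣ initial n j ∣ ≡ j
  ∣initial∣ {zero}  {zero}  z≤n       = refl
  ∣initial∣ {suc n} {zero}  z≤n       = ∣initial∣ {n} z≤n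
  ∣initial∣ {suc n} {suc j} (s≤s j≤n) = cong suc (∣initial∣ j≤n)

  p⊆q∧∣p∣≡∣q∣⇒p≡q : p ⊆ q → ∣ p ∣ ≡ ∣ q ∣ → p ≡ q
  p⊆q∧∣p∣≡∣q∣⇒p≡q {p = []}          {[]}          _   _ = refl
  p⊆q∧∣p∣≡∣q∣⇒p≡q {p = inside ∷ p}  {inside ∷ q}  p⊆q e =
    cong (inside ∷_) (p⊆q∧∣p∣≡∣q∣⇒p≡q (drop-∷-⊆ p⊆q) (ℕP.suc-injective e))
  p⊆q∧∣p∣≡∣q∣⇒p≡q {p = inside ∷ p}  {outside ∷ q} p⊆q e = contradiction (p⊆q here) λ ()
  p⊆q∧∣p∣≡∣q∣⇒p≡q {p = outside ∷ p} {inside ∷ q}  p⊆q e =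
    contradiction e (ℕP.<⇒≢ (s≤s (p⊆q⇒∣p∣≤∣q∣ (drop-∷-⊆ p⊆q))))
  p⊆q∧∣p∣≡∣q∣⇒p≡q {p = outside ∷ p} {outside ∷ q} p⊆q e =
    cong (outside ∷_) (p⊆q∧∣p∣≡∣q∣⇒p≡q (drop-∷-⊆ p⊆q) e)

  private
    ∃∉-there : ∀ {b c} → (∃ λ x → x ∈ p × x ∉ q) → ∃ λ x → x ∈ b ∷ p × x ∉ c ∷ q
    ∃∉-there (x , x∈p , x∉q) = suc x , there x∈p , x∉q ∘ drop-there

  ⊆⊎∃∉ : ∀ (p q : Subset n) → p ⊆ q ⊎ ∃ λ x → x ∈ p × x ∉ q
  ⊆⊎∃∉ []            []            = inj₁ id
  ⊆⊎∃∉ (inside ∷ p)  (outside ∷ q) = inj₂ (zero , here , λ ())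
  ⊆⊎∃∉ (outside ∷ p) (_ ∷ q)       = Sum.map out⊆ ∃∉-there (⊆⊎∃∉ p q)
  ⊆⊎∃∉ (inside ∷ p)  (inside ∷ q)  = Sum.map s⊆s ∃∉-there (⊆⊎∃∉ p q)

  ⊆⇒∩≡ : p ⊆ q → q ∩ p ≡ p
  ⊆⇒∩≡ {p = []}          {[]}          _   = refl
  ⊆⇒∩≡ {p = outside ∷ p} {b ∷ q}       p⊆q = cong₂ _∷_ (∧-zeroʳ b) (⊆⇒∩≡ (drop-∷-⊆ p⊆q))
  ⊆⇒∩≡ {p = inside ∷ p}  {inside ∷ q}  p⊆q = cong (inside ∷_) (⊆⇒∩≡ (drop-∷-⊆ p⊆q))
  ⊆⇒∩≡ {p = inside ∷ p}  {outside ∷ q} p⊆q = contradiction (p⊆q here) λ ()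

  ⊆⇒∪≡ : p ⊆ q → q ∪ p ≡ q
  ⊆⇒∪≡ {p = []}          {[]}          _   = refl
  ⊆⇒∪≡ {p = outside ∷ p} {b ∷ q}       p⊆q = cong₂ _∷_ (∨-identityʳ b) (⊆⇒∪≡ (drop-∷-⊆ p⊆q))
  ⊆⇒∪≡ {p = inside ∷ p}  {inside ∷ q}  p⊆q = cong (inside ∷_) (⊆⇒∪≡ (drop-∷-⊆ p⊆q))
  ⊆⇒∪≡ {p = inside ∷ p}  {outside ∷ q} p⊆q = contradiction (p⊆q here) λ ()

  ∣p∣≡suc⇒Nonempty : ∀ {k} (p : Subset n) → ∣ p ∣ ≡ suc k → Nonempty p
  ∣p∣≡suc⇒Nonempty (inside ∷ p)  _ = zero , here
  ∣p∣≡suc⇒Nonempty (outside ∷ p) e with ∣p∣≡suc⇒Nonempty p e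
  ... | x , x∈p = suc x , there x∈p

module Elements (K : Field) where
  open FieldAlgebra K
  open AlternatingSums K using (altSum; altSum-map; altSum-picks-map)
  open Determinants K using (det; detL≡det)
  open FinSubsets

  private variable
    n : ℕ

  length-elems : ∀ (p : Subset n) → length (elems K p) ≡ ∣ p ∣
  length-elems []            = refl
  length-elems (inside ∷ p)  = cong suc (trans (length-map suc (elems K p)) (length-elems p))
  length-elems (outside ∷ p) = trans (length-map suc (elems K p)) (length-elems p)

  elems-∈ : ∀ (p : Subset n) → All (_∈ p) (elems K p)
  elems-∈ []            = []
  elems-∈ (inside ∷ p)  = here ∷ map⁺ (All.map there (elems-∈ p))
  elems-∈ (outside ∷ p) = map⁺ (All.map there (elems-∈ p))

  ∈-elems : ∀ {p : Subset n} {x} → x ∈ p → x ∈ˡ elems K p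
  ∈-elems                    here        = Any.here refl
  ∈-elems {p = inside ∷ _}  (there x∈p) = Any.there (∈-map⁺ suc (∈-elems x∈p))
  ∈-elems {p = outside ∷ _} (there x∈p) = ∈-map⁺ suc (∈-elems x∈p)

  elems-⊆ : ∀ {p q : Subset n} → p ⊆ q → elems K p ⊆ˡ elems K q
  elems-⊆ {p = p} p⊆q x∈p = ∈-elems (p⊆q (All.lookup (elems-∈ p) x∈p))

  elems-⊥ : ∀ n → elems K (⊥ {n}) ≡ []
  elems-⊥ zero    = refl
  elems-⊥ (suc n) = cong (map suc) (elems-⊥ n)

  altSum-picks-elems : ∀ (p : Subset n) g →
    altSum (picks K (elems K p)) g ≡ altSum (elems K p) (λ y → g (y , elems K (remove p y)))
  altSum-picks-elems []            g = refl
  altSum-picks-elems (inside ∷ p)  g = cong (_-_ (g (zero , elems K (outside ∷ p)))) (begin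
    altSum (map _ (picks K (map suc (elems K p)))) g
      ≡⟨ altSum-map _ (picks K (map suc (elems K p))) g ⟩
    altSum (picks K (map suc (elems K p))) (λ q → g (proj₁ q , zero ∷ proj₂ q))
      ≡⟨ altSum-picks-map suc (elems K p) _ ⟩
    altSum (picks K (elems K p)) (λ q → g (suc (proj₁ q) , zero ∷ map suc (proj₂ q)))
      ≡⟨ altSum-picks-elems p _ ⟩
    altSum (elems K p) (λ y → g (suc y , elems K (inside ∷ remove p y)))
      ≡⟨ sym (altSum-map suc (elems K p) _) ⟩
    altSum (map suc (elems K p)) (λ y → g (y , elems K (remove (inside ∷ p) y))) ∎)
    where open ≡-Reasoning
  altSum-picks-elems (outside ∷ p) g = begin
    altSum (picks K (map suc (elems K p))) g
      ≡⟨ altSum-picks-map suc (elems K p) g ⟩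
    altSum (picks K (elems K p)) (λ q → g (suc (proj₁ q) , map suc (proj₂ q)))
      ≡⟨ altSum-picks-elems p _ ⟩
    altSum (elems K p) (λ y → g (suc y , elems K (outside ∷ remove p y)))
      ≡⟨ sym (altSum-map suc (elems K p) _) ⟩
    altSum (map suc (elems K p)) (λ y → g (y , elems K (remove (outside ∷ p) y))) ∎
    where open ≡-Reasoning

  elems-insert : ∀ (p : Subset n) y → y ∉ p →
    ∃₂ λ A C → elems K (insert p y) ≡ A ++ y ∷ C × elems K p ≡ A ++ C
  elems-insert (inside ∷ p)  zero    y∉p = contradiction here y∉p
  elems-insert (outside ∷ p) zero    _   = [] , map suc (elems K p) , refl , refl
  elems-insert (inside ∷ p)  (suc y) y∉p with elems-insert p y (y∉p ∘ there)
  ... | A , C , e₁ , e₂ = zero ∷ map suc A , map suc C ,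
    cong (zero ∷_) (trans (cong (map suc) e₁) (map-++ suc A (y ∷ C))) ,
    cong (zero ∷_) (trans (cong (map suc) e₂) (map-++ suc A C))
  elems-insert (outside ∷ p) (suc y) y∉p with elems-insert p y (y∉p ∘ there)
  ... | A , C , e₁ , e₂ = map suc A , map suc C ,
    trans (cong (map suc) e₁) (map-++ suc A (y ∷ C)) ,
    trans (cong (map suc) e₂) (map-++ suc A C)

  elems-initial : ∀ n j → elems K (initial n j) ≡ take j (allFin n)
  elems-initial zero    zero    = refl
  elems-initial zero    (suc j) = refl
  elems-initial (suc n) zero    = cong (map suc) (elems-initial n zero)
  elems-initial (suc n) (suc j) = cong (zero ∷_) (begin
    map suc (elems K (initial n j))     ≡⟨ cong (map suc) (elems-initial n j) ⟩
    map suc (take j (allFin n))         ≡⟨ take-map j (allFin n) ⟨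
    take j (map suc (tabulate id))      ≡⟨ cong (take j) (map-tabulate id suc) ⟩
    take j (tabulate suc)               ∎)
    where open ≡-Reasoning

  minor≡det : ∀ (B : Matrix K n) S T → ∣ S ∣ ≡ ∣ T ∣ → minor K B T S ≡ det B (elems K T) (elems K S)
  minor≡det B S T ∣S∣≡∣T∣ =
    detL≡det B (elems K T) (elems K S) (trans (length-elems T) (trans (sym ∣S∣≡∣T∣) (sym (length-elems S))))

  topMinor≡det : ∀ (B : Matrix K n) S → topMinor K B S ≡ det B (elems K (initial n ∣ S ∣)) (elems K S)
  topMinor≡det {n} B S = begin
    detL K B (take ∣ S ∣ (allFin n)) (elems K S)
      ≡⟨ cong (λ rs → detL K B rs (elems K S)) (elems-initial n ∣ S ∣) ⟨
    detL K B (elems K (initial n ∣ S ∣)) (elems K S)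
      ≡⟨ detL≡det B (elems K (initial n ∣ S ∣)) (elems K S) equal-lengths ⟩
    det B (elems K (initial n ∣ S ∣)) (elems K S)     ∎
    where
    open ≡-Reasoning
    equal-lengths : length (elems K (initial n ∣ S ∣)) ≡ length (elems K S)
    equal-lengths = trans (length-elems (initial n ∣ S ∣)) (trans (∣initial∣ (∣p∣≤n S)) (sym (length-elems S)))

module OrderedFieldLemmas (R : RealField) where
  open RealField R using (_≤_; isTotalOrder; +-mono-≤)
  open IsTotalOrder isTotalOrder using (total; antisym) renaming (trans to ≤-trans)
  module ℝ = FieldAlgebra (RealField.field′ R)
  open ℝ public using () renaming (_+_ to _⊕_; _-_ to _⊖_; -_ to ⊝_; 0# to 0ℝ)

  ⊕-mono-≤ : ∀ {a b c d} → a ≤ b → c ≤ d → a ⊕ c ≤ b ⊕ d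
  ⊕-mono-≤ {a} {b} {c} {d} a≤b c≤d = ≤-trans (+-mono-≤ c a≤b)
    (subst₂ _≤_ (ℝ.+-comm c b) (ℝ.+-comm d b) (+-mono-≤ b c≤d))

  ⊝-antitone : ∀ {a b} → a ≤ b → ⊝ b ≤ ⊝ a
  ⊝-antitone {a} {b} a≤b = subst₂ _≤_
    (ℝ.solve 2 (λ a b → a ℝ.:+ (ℝ.:- a ℝ.:- b) ℝ.:= ℝ.:- b) refl a b)
    (ℝ.solve 2 (λ a b → b ℝ.:+ (ℝ.:- a ℝ.:- b) ℝ.:= ℝ.:- a) refl a b)
    (+-mono-≤ (⊝ a ⊖ b) a≤b)

  w⊕w≡0⇒w≡0 : ∀ {w} → w ⊕ w ≡ 0ℝ → w ≡ 0ℝ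
  w⊕w≡0⇒w≡0 {w} w⊕w≡0 with total w 0ℝ
  ... | inj₁ w≤0 = antisym w≤0 (subst₂ _≤_ w⊕w≡0 (ℝ.+-identityˡ w) (+-mono-≤ w w≤0))
  ... | inj₂ 0≤w = antisym (subst₂ _≤_ (ℝ.+-identityˡ w) w⊕w≡0 (+-mono-≤ w 0≤w)) 0≤w

module ValuationBounds (K : Field) (R : RealField) (v : Valuation K R) where
  open FieldAlgebra K
  open AlternatingSums K using (sign; altSum; altSum-++)
  open Valuation v
  open RealField R using (_≤_; isTotalOrder; +-mono-≤) renaming (Carrier to ℝ)
  open IsTotalOrder isTotalOrder using () renaming (refl to ≤-refl; trans to ≤-trans)
  open OrderedFieldLemmas R public
  open ≡-Reasoning

  private
    fin-injective : ∀ {a b} → fin {R} a ≡ fin b → a ≡ b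
    fin-injective refl = refl

  val-1# : val 1# ≡ fin 0ℝ
  val-1# with val 1# in val1≡
  ... | ∞     = contradiction (sym (val-∞ 1# val1≡)) (Field.0≢1 K)
  ... | fin a = cong fin (ℝ.x+x≈x⇒x≈0 a (fin-injective (begin
    fin (a ⊕ a)              ≡⟨ cong (λ u → u +⁺ u) val1≡ ⟨
    val 1# +⁺ val 1#         ≡⟨ val-* 1# 1# ⟨
    val (1# * 1#)            ≡⟨ cong val (*-identityˡ 1#) ⟩
    val 1#                   ≡⟨ val1≡ ⟩
    fin a                    ∎)))

  val-neg : ∀ x → val (- x) ≡ val x
  val-neg x = begin
    val (- x)              ≡⟨ cong val (-1*x≈-x x) ⟨
    val (- 1# * x)         ≡⟨ val-* (- 1#) x ⟩
    val (- 1#) +⁺ val x    ≡⟨ cong (_+⁺ val x) val-[-1] ⟩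
    fin 0ℝ +⁺ val x        ≡⟨ fin0+⁺ (val x) ⟩
    val x                  ∎
    where
    fin0+⁺ : ∀ u → fin 0ℝ +⁺ u ≡ u
    fin0+⁺ (fin a) = cong fin (ℝ.+-identityˡ a)
    fin0+⁺ ∞       = refl
    val-[-1] : val (- 1#) ≡ fin 0ℝ
    val-[-1] with val (- 1#) in val-1≡
    ... | ∞     = contradiction (trans (sym (-‿involutive 1#)) (trans (cong -_ (val-∞ (- 1#) val-1≡)) -0#≈0#))
                                (≢-sym (Field.0≢1 K))
    ... | fin w = cong fin (w⊕w≡0⇒w≡0 (fin-injective (begin
      fin (w ⊕ w)               ≡⟨ cong (λ u → u +⁺ u) val-1≡ ⟨
      val (- 1#) +⁺ val (- 1#)  ≡⟨ val-* (- 1#) (- 1#) ⟨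
      val (- 1# * - 1#)         ≡⟨ cong val (solve 0 (:- con 1ℤ :* :- con 1ℤ := con 1ℤ) refl) ⟩
      val 1#                    ≡⟨ val-1# ⟩
      fin 0ℝ                    ∎)))

  ν-1# : ν 1# ≡ real 0ℝ
  ν-1# = trans (cong neg val-1#) (cong real ℝ.-0#≈0#)

  ν-neg : ∀ x → ν (- x) ≡ ν x
  ν-neg x = cong neg (val-neg x)

  ν-sign* : ∀ k x → ν (sign k * x) ≡ ν x
  ν-sign* zero    x = cong ν (*-identityˡ x)
  ν-sign* (suc k) x = begin
    ν (- sign k * x)     ≡⟨ cong ν (-‿distribˡ-* (sign k) x) ⟨
    ν (- (sign k * x))   ≡⟨ ν-neg (sign k * x) ⟩
    ν (sign k * x)       ≡⟨ ν-sign* k x ⟩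
    ν x                  ∎

  infix 4 _≼_
  _≼_ : Carrier → ℝ → Set
  x ≼ a = ν x ≤⁻ real a

  0≼ : ∀ a → 0# ≼ a
  0≼ a rewrite val-0 = -∞≤ (real a)

  ≼-reflexive : ∀ {x a} → ν x ≡ real a → x ≼ a
  ≼-reflexive ν≡a = subst (_≤⁻ real _) (sym ν≡a) (real≤real ≤-refl)

  ≼-≤-trans : ∀ {x a b} → x ≼ a → a ≤ b → x ≼ b
  ≼-≤-trans = ≤⁻-≤-trans
    where
    ≤⁻-≤-trans : ∀ {u : ℝ-∞ R} {a b} → u ≤⁻ real a → a ≤ b → u ≤⁻ real b
    ≤⁻-≤-trans (-∞≤ _)        a≤b = -∞≤ _
    ≤⁻-≤-trans (real≤real u≤a) a≤b = real≤real (≤-trans u≤a a≤b)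

  ≼-neg : ∀ {x a} → x ≼ a → - x ≼ a
  ≼-neg {x} = subst (_≤⁻ real _) (sym (ν-neg x))

  ≼-sign* : ∀ k {x a} → x ≼ a → sign k * x ≼ a
  ≼-sign* k {x} = subst (_≤⁻ real _) (sym (ν-sign* k x))

  private
    neg-antitone : ∀ {u w : ℝ+∞ R} {a} → u ≤⁺ w → neg u ≤⁻ real a → neg w ≤⁻ real a
    neg-antitone (fin≤fin u≤w) (real≤real ≤a) = real≤real (≤-trans (⊝-antitone u≤w) ≤a)
    neg-antitone (_ ≤∞)        _              = -∞≤ _

    neg-+⁺ : ∀ (u w : ℝ+∞ R) {a b} → neg u ≤⁻ real a → neg w ≤⁻ real b → neg (u +⁺ w) ≤⁻ real (a ⊕ b)
    neg-+⁺ (fin u) (fin w) (real≤real ≤a) (real≤real ≤b) = real≤real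
      (subst (_≤ _) (ℝ.-‿+-comm u w) (⊕-mono-≤ ≤a ≤b))
    neg-+⁺ (fin u) ∞       _ _ = -∞≤ _
    neg-+⁺ ∞       w       _ _ = -∞≤ _

    neg-+⁺-cancel : ∀ (u w : ℝ+∞ R) {b c} → neg u ≡ real b → neg (u +⁺ w) ≤⁻ real c → neg w ≤⁻ real (c ⊖ b)
    neg-+⁺-cancel (fin u) (fin w) refl (real≤real ≤c) = real≤real (subst₂ _≤_
      (ℝ.solve 2 (λ u w → ℝ.:- (u ℝ.:+ w) ℝ.:- ℝ.:- u ℝ.:= ℝ.:- w) refl u w) refl (+-mono-≤ (⊝ ⊝ u) ≤c))
    neg-+⁺-cancel (fin u) ∞       refl _ = -∞≤ _

    neg-+⁺-exact : ∀ (u w : ℝ+∞ R) {a d} → neg u ≡ real a → neg (u +⁺ w) ≡ real d → neg w ≡ real (d ⊖ a)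
    neg-+⁺-exact (fin u) (fin w) refl refl = cong real
      (ℝ.solve 2 (λ u w → ℝ.:- w ℝ.:= ℝ.:- (u ℝ.:+ w) ℝ.:- ℝ.:- u) refl u w)

  ≼-+ : ∀ {x y a} → x ≼ a → y ≼ a → x + y ≼ a
  ≼-+ {x} {y} x≼a y≼a with val-nonarch x y
  ... | inj₁ vx≤ = neg-antitone vx≤ x≼a
  ... | inj₂ vy≤ = neg-antitone vy≤ y≼a

  ≼-* : ∀ {x y a b} → x ≼ a → y ≼ b → x * y ≼ a ⊕ b
  ≼-* {x} {y} x≼a y≼b rewrite val-* x y = neg-+⁺ (val x) (val y) x≼a y≼b

  ≼-cancelˡ : ∀ {x y b c} → ν x ≡ real b → x * y ≼ c → y ≼ c ⊖ b
  ≼-cancelˡ {x} {y} νx≡b xy≼c rewrite val-* x y = neg-+⁺-cancel (val x) (val y) νx≡b xy≼c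

  ν-cancelˡ : ∀ {x y a d} → ν x ≡ real a → ν (x * y) ≡ real d → ν y ≡ real (d ⊖ a)
  ν-cancelˡ {x} {y} νx≡a νxy≡d rewrite val-* x y = neg-+⁺-exact (val x) (val y) νx≡a νxy≡d

  ≼-altSum : ∀ {A : Set} {xs : List A} {f a} → All (λ x → f x ≼ a) xs → altSum xs f ≼ a
  ≼-altSum {a = a} []            = 0≼ a
  ≼-altSum         (fx≼a ∷ f≼a) = ≼-+ fx≼a (≼-neg (≼-altSum f≼a))

  ≼-isolate : ∀ {A : Set} (As : List A) x Cs {f a} → altSum (As ++ x ∷ Cs) f ≼ a →
    All (λ y → f y ≼ a) As → All (λ y → f y ≼ a) Cs → f x ≼ a
  ≼-isolate As x Cs {f} {a} total≼a As≼a Cs≼a =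
    subst (_≤⁻ real a) (ν-sign* (length As) (f x)) (subst (_≼ a) (sym σfx≡) bound)
    where
    σ = sign (length As)
    SA = altSum As f
    SC = altSum Cs f
    σfx≡ : σ * f x ≡ (altSum (As ++ x ∷ Cs) f - SA) + σ * SC
    σfx≡ = begin
      σ * f x
        ≡⟨ solve 4 (λ s fx a c → s :* fx := ((a :+ s :* (fx :- c)) :- a) :+ s :* c) refl σ (f x) SA SC ⟩
      ((SA + σ * (f x - SC)) - SA) + σ * SC     ≡⟨ cong (λ t → (t - SA) + σ * SC) (altSum-++ As (x ∷ Cs) f) ⟨
      (altSum (As ++ x ∷ Cs) f - SA) + σ * SC  ∎
    bound : (altSum (As ++ x ∷ Cs) f - SA) + σ * SC ≼ a
    bound = ≼-+ (≼-+ total≼a (≼-neg (≼-altSum As≼a))) (≼-sign* (length As) (≼-altSum Cs≼a))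

module TopMinorBound (K : Field) (R : RealField) (v : Valuation K R) where
  open FieldAlgebra K
  open AlternatingSums K
  open Determinants K
  open FinSubsets
  open Elements K
  open ValuationBounds K R v
  open Valuation v using (ν)
  open RealField R using (_≤_; +-mono-≤) renaming (Carrier to ℝ)
  open Nat using (_<_; z≤n; s≤s) renaming (_≤_ to _≤ℕ_)
  open ≡-Reasoning

  private variable
    n : ℕ

  ν-det-insertRow : ∀ {C : Set} (M : Fin n → C → Carrier) (p : Subset n) y cs → y ∉ p →
    ν (det M (y ∷ elems K p) cs) ≡ ν (det M (elems K (insert p y)) cs)
  ν-det-insertRow M p y cs y∉p with elems-insert p y y∉p
  ... | A , Cs , elems-insert≡ , elems≡ = begin
    ν (det M (y ∷ elems K p) cs)                   ≡⟨ cong (λ rs → ν (det M (y ∷ rs) cs)) elems≡ ⟩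
    ν (det M (y ∷ A ++ Cs) cs)                     ≡⟨ ν-sign* (length A) _ ⟨
    ν (sign (length A) * det M (y ∷ A ++ Cs) cs)   ≡⟨ cong ν (det-moveRow M A y Cs cs) ⟨
    ν (det M (A ++ y ∷ Cs) cs)                     ≡⟨ cong (λ rs → ν (det M rs cs)) elems-insert≡ ⟨
    ν (det M (elems K (insert p y)) cs)            ∎

  det-emptyMinor : ∀ (M : Matrix K n) → det M (elems K (initial n ∣ ⊥ {n} ∣)) (elems K (⊥ {n})) ≡ 1#
  det-emptyMinor {n} M = cong₂ (det M)
    (trans (cong (λ k → elems K (initial n k)) (∣⊥∣≡0 n)) (elems-initial n 0)) (elems-⊥ n)

  ValuesTopMinors : Matrix K n → (Subset n → ℝ) → Set
  ValuesTopMinors {n} B F = ∀ S → ν (det B (elems K (initial n ∣ S ∣)) (elems K S)) ≡ real (F S)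

  BoundsMinors : Matrix K n → (Subset n → ℝ) → Set
  BoundsMinors B F = ∀ S T → ∣ S ∣ ≡ ∣ T ∣ → det B (elems K T) (elems K S) ≼ F S

  shift : Matrix K (suc n) → Matrix K n
  shift B i j = B (suc i) (suc j)

  module InductionStep {m} (B : Matrix K (suc m)) (ut : UpperTriangular K B) (F : Subset (suc m) → ℝ)
                       (hF : ValuesTopMinors B F) (sub : Submodular R F) where

    B′ : Matrix K m
    B′ = shift B

    c : ℝ
    c = F (inside ∷ ⊥)

    F′ : Subset m → ℝ
    F′ X = F (inside ∷ X) ⊖ c

    _⁺ : Subset m → List (Fin (suc m))
    p ⁺ = map suc (elems K p)

    ut′ : UpperTriangular K B′
    ut′ i j j<i = ut (suc i) (suc j) (s≤s j<i)

    firstColumn-vanishes : ∀ rs (g : List (Fin (suc m)) → Carrier) →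
      altSum (picks K (map suc rs)) (uncurry λ r rs′ → B r zero * g rs′) ≡ 0#
    firstColumn-vanishes rs g = trans (altSum-picks-map suc rs _) (altSum-zero (All.universal
      (λ p → trans (cong (_* g (map suc (proj₂ p))) (ut (suc (proj₁ p)) zero (s≤s z≤n))) (zeroˡ _))
      (picks K rs)))

    det-zeroColumn : ∀ rs cs → det B (map suc rs) (zero ∷ cs) ≡ 0#
    det-zeroColumn rs cs =
      trans (det-expandColumn B (map suc rs) zero cs) (firstColumn-vanishes rs (λ rs′ → det B rs′ cs))

    det-cofactor₀₀ : ∀ rs cs → det B (zero ∷ map suc rs) (zero ∷ map suc cs) ≡ B zero zero * det B′ rs cs
    det-cofactor₀₀ rs cs = begin
      det B (zero ∷ map suc rs) (zero ∷ map suc cs)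
        ≡⟨ det-expandColumn B (zero ∷ map suc rs) zero (map suc cs) ⟩
      B zero zero * det B (map suc rs) (map suc cs) - altSum (map _ (picks K (map suc rs))) _
        ≡⟨ cong₂ _-_ (cong (B zero zero *_) (det-map B suc suc rs cs))
                     (trans (altSum-map _ (picks K (map suc rs)) _)
                            (firstColumn-vanishes rs (λ rs′ → det B (zero ∷ rs′) (map suc cs)))) ⟩
      B zero zero * det B′ rs cs - 0#
        ≡⟨ solve 1 (λ x → x :- con 0ℤ := x) refl _ ⟩
      B zero zero * det B′ rs cs ∎

    ν-B₀₀ : ν (B zero zero) ≡ real c
    ν-B₀₀ = begin
      ν (B zero zero)                             ≡⟨ cong ν (*-identityʳ _) ⟨
      ν (B zero zero * 1#)                        ≡⟨ cong (λ d → ν (B zero zero * d)) (det-emptyMinor B′) ⟨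
      ν (B zero zero * det B′ (elems K (initial m ∣ ⊥ {m} ∣)) (elems K (⊥ {m})))
        ≡⟨ cong ν (det-cofactor₀₀ (elems K (initial m ∣ ⊥ {m} ∣)) (elems K (⊥ {m}))) ⟨
      ν (det B (elems K (initial (suc m) ∣ inside ∷ ⊥ {m} ∣)) (elems K (inside ∷ ⊥ {m})))
        ≡⟨ hF (inside ∷ ⊥) ⟩
      real c                                      ∎

    F⊥≡0 : F ⊥ ≡ 0ℝ
    F⊥≡0 = real-injective (trans (sym (hF ⊥)) (trans (cong ν (det-emptyMinor B)) ν-1#))
      where
      real-injective : ∀ {a b} → real {R} a ≡ real b → a ≡ b
      real-injective refl = refl

    hF′ : ValuesTopMinors B′ F′
    hF′ X = ν-cancelˡ ν-B₀₀ (begin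
      ν (B zero zero * det B′ (elems K (initial m ∣ X ∣)) (elems K X))
        ≡⟨ cong ν (det-cofactor₀₀ (elems K (initial m ∣ X ∣)) (elems K X)) ⟨
      ν (det B (elems K (initial (suc m) ∣ inside ∷ X ∣)) (elems K (inside ∷ X)))
        ≡⟨ hF (inside ∷ X) ⟩
      real (F (inside ∷ X)) ∎)

    sub′ : Submodular R F′
    sub′ X Y = subst₂ _≤_ (shift-by-c _ _) (shift-by-c _ _) (+-mono-≤ (⊝ c ⊖ c) (sub (inside ∷ X) (inside ∷ Y)))
      where
      shift-by-c : ∀ a b → (a ⊕ b) ⊕ (⊝ c ⊖ c) ≡ (a ⊖ c) ⊕ (b ⊖ c)
      shift-by-c a b =
        ℝ.solve 3 (λ a b c → (a ℝ.:+ b) ℝ.:+ (ℝ.:- c ℝ.:- c) ℝ.:= (a ℝ.:- c) ℝ.:+ (b ℝ.:- c)) refl a b c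

    exchange-submodular : ∀ {X X′} → X′ ⊆ X → F (outside ∷ X′) ⊕ F′ X ≤ F (outside ∷ X) ⊕ F′ X′
    exchange-submodular {X} {X′} X′⊆X =
      subst₂ _≤_ (ℝ.+-assoc _ _ _) (ℝ.+-assoc _ _ _) (+-mono-≤ (⊝ c)
        (subst₂ (λ Y Z → F (outside ∷ Y) ⊕ F (inside ∷ Z) ≤ F (outside ∷ X) ⊕ F (inside ∷ X′))
                (⊆⇒∩≡ X′⊆X) (⊆⇒∪≡ X′⊆X) (sub (outside ∷ X) (inside ∷ X′))))

    F′≤F : ∀ X → F′ X ≤ F (outside ∷ X)
    F′≤F X = subst₂ _≤_ (trans (cong (_⊕ F′ X) F⊥≡0) (ℝ.+-identityˡ _))
                        (trans (cong (F (outside ∷ X) ⊕_) (ℝ.-‿inverseʳ c)) (ℝ.+-identityʳ _))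
                        (exchange-submodular ⊥⊆)

    module _ (IH : BoundsMinors B′ F′) where

      Row₀Bound : Subset m → Subset m → Set
      Row₀Bound X Y = det B (zero ∷ Y ⁺) (X ⁺) ≼ F (outside ∷ X)

      topMinor-bound : ∀ X j → ∣ X ∣ ≡ suc j → Row₀Bound X (initial m j)
      topMinor-bound X j ∣X∣≡1+j = ≼-reflexive (subst
        (λ k → ν (det B (elems K (initial (suc m) k)) (X ⁺)) ≡ real (F (outside ∷ X)))
        ∣X∣≡1+j (hF (outside ∷ X)))

      -- The Plücker relation for the rows {0} ∪ (Y + y₀) against the columns X and X′ = X - s
      -- expresses the goal's minor, times a cofactor of known valuation, through minors that are
      -- bounded already: those with fewer rows (`smaller`) or with a smaller weight (`lighter`).
      module Exchange {j} {X Y : Subset m} {y₀ : Fin m}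
        (∣Y∣≡1+j : ∣ Y ∣ ≡ suc j) (∣X∣≡2+j : ∣ X ∣ ≡ suc (suc j))
        (y₀∈initial : y₀ ∈ initial m (suc j)) (y₀∉Y : y₀ ∉ Y)
        (smaller : ∀ X′ I → ∣ I ∣ ≡ j → ∣ X′ ∣ ≡ suc j → Row₀Bound X′ I)
        (lighter : ∀ Y′ → weight Y′ < weight Y → ∣ Y′ ∣ ≡ suc j → Row₀Bound X Y′) where

        s : Fin m
        s = proj₁ (∣p∣≡suc⇒Nonempty X ∣X∣≡2+j)

        X′ I J : Subset m
        X′ = remove X s
        I  = remove (initial m (suc j)) y₀
        J  = insert Y y₀

        ∣X′∣≡1+j : ∣ X′ ∣ ≡ suc j
        ∣X′∣≡1+j = ℕP.suc-injective (trans (∣remove∣ (proj₂ (∣p∣≡suc⇒Nonempty X ∣X∣≡2+j))) ∣X∣≡2+j)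

        ∣I∣≡j : ∣ I ∣ ≡ j
        ∣I∣≡j = ℕP.suc-injective (trans (∣remove∣ y₀∈initial) (∣initial∣ 1+j≤m))
          where 1+j≤m = subst (_≤ℕ m) ∣Y∣≡1+j (∣p∣≤n Y)

        ∣J∣≡2+j : ∣ J ∣ ≡ suc (suc j)
        ∣J∣≡2+j = trans (∣insert∣ Y y₀ y₀∉Y) (cong suc ∣Y∣≡1+j)

        β : ℝ
        β = F (outside ∷ X) ⊕ F′ X′

        Ψ : Fin m → Carrier
        Ψ y = det B (suc y ∷ I ⁺) (X′ ⁺) * det B (zero ∷ remove J y ⁺) (X ⁺)

        leading : Carrier
        leading = det B (zero ∷ I ⁺) (X′ ⁺) * det B (J ⁺) (X ⁺)

        exchange-relation : leading ≡ altSum (elems K J) Ψ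
        exchange-relation = x∙y⁻¹≈ε⇒x≈y leading (altSum (elems K J) Ψ) (begin
          leading - altSum (elems K J) Ψ
            ≡⟨ cong (_-_ leading) (altSum-picks-elems J _) ⟨
          leading - altSum (picks K (elems K J)) (λ q → G (suc (proj₁ q) , zero ∷ map suc (proj₂ q)))
            ≡⟨ cong (_-_ leading) (altSum-picks-map suc (elems K J) _) ⟨
          leading - altSum (picks K (J ⁺)) (λ q → G (proj₁ q , zero ∷ proj₂ q))
            ≡⟨ cong (_-_ leading) (altSum-map _ (picks K (J ⁺)) G) ⟨
          altSum (picks K (zero ∷ J ⁺)) G
            ≡⟨ det-plücker B (I ⁺) (zero ∷ J ⁺) (X′ ⁺) (X ⁺) (⊆ˡ.map⁺ suc (elems-⊆ (remove-⊆ X s))) ⟩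
          0# ∎)
          where
          G : Fin (suc m) × List (Fin (suc m)) → Carrier
          G = uncurry λ r rs → det B (r ∷ I ⁺) (X′ ⁺) * det B rs (X ⁺)

        leading-bound : leading ≼ β
        leading-bound = ≼-≤-trans (≼-* (smaller X′ I ∣I∣≡j ∣X′∣≡1+j) shifted-bound)
                                  (exchange-submodular (remove-⊆ X s))
          where
          shifted-bound : det B (J ⁺) (X ⁺) ≼ F′ X
          shifted-bound = subst (_≼ F′ X) (sym (det-map B suc suc (elems K J) (elems K X)))
                                (IH X J (trans ∣X∣≡2+j (sym ∣J∣≡2+j)))

        other-bound : ∀ y → y ∈ Y → Ψ y ≼ β
        other-bound y y∈Y with y ∈? I
        ... | yes y∈I = subst (_≼ β) (sym (trans (cong (_* _) repeated) (zeroˡ _))) (0≼ β)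
          where
          repeated : det B (suc y ∷ I ⁺) (X′ ⁺) ≡ 0#
          repeated = det-repeatedRow B (X′ ⁺) (∈-map⁺ suc (∈-elems y∈I))
        ... | no y∉I = subst (Ψ y ≼_) (ℝ.+-comm _ _) (≼-* row-bound rest-bound)
          where
          row-bound : det B (suc y ∷ I ⁺) (X′ ⁺) ≼ F′ X′
          row-bound = subst (_≤⁻ real (F′ X′))
            (sym (trans (cong ν (det-map B suc suc (y ∷ elems K I) (elems K X′)))
                        (ν-det-insertRow B′ I y (elems K X′) y∉I)))
            (IH X′ (insert I y) (trans ∣X′∣≡1+j (sym (trans (∣insert∣ I y y∉I) (cong suc ∣I∣≡j)))))
          y₀<y : toℕ y₀ < toℕ y
          y₀<y = ℕP.<-≤-trans (∈-initial⁻ y₀∈initial) (ℕP.≮⇒≥ λ y<1+j →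
                   y∉I (∈-remove⁺ (∈-initial⁺ y<1+j) λ { refl → y₀∉Y y∈Y }))
          rest-bound : det B (zero ∷ remove J y ⁺) (X ⁺) ≼ F (outside ∷ X)
          rest-bound = lighter (remove J y) (weight-exchange Y y₀∉Y y∈Y y₀<y)
                               (ℕP.suc-injective (trans (∣remove∣ (∈-insert⁺ y₀ y∈Y)) ∣J∣≡2+j))

        Ψy₀-bound : Ψ y₀ ≼ β
        Ψy₀-bound with elems-insert Y y₀ y₀∉Y
        ... | As , Cs , elemsJ≡ , elemsY≡ =
          ≼-isolate As y₀ Cs relation-bound (++⁻ˡ As others-bound) (++⁻ʳ As others-bound)
          where
          relation-bound : altSum (As ++ y₀ ∷ Cs) Ψ ≼ β
          relation-bound = subst (λ ys → altSum ys Ψ ≼ β) elemsJ≡ (subst (_≼ β) exchange-relation leading-bound)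
          others-bound : All (λ y → Ψ y ≼ β) (As ++ Cs)
          others-bound = All.map (other-bound _) (subst (All (_∈ Y)) elemsY≡ (elems-∈ Y))

        cofactor : ν (det B (suc y₀ ∷ I ⁺) (X′ ⁺)) ≡ real (F′ X′)
        cofactor = begin
          ν (det B (suc y₀ ∷ I ⁺) (X′ ⁺))
            ≡⟨ cong ν (det-map B suc suc (y₀ ∷ elems K I) (elems K X′)) ⟩
          ν (det B′ (y₀ ∷ elems K I) (elems K X′))
            ≡⟨ ν-det-insertRow B′ I y₀ (elems K X′) (y∉remove (initial m (suc j)) y₀) ⟩
          ν (det B′ (elems K (insert I y₀)) (elems K X′))
            ≡⟨ cong (λ Z → ν (det B′ (elems K Z) (elems K X′))) (insert-remove y₀∈initial) ⟩
          ν (det B′ (elems K (initial m (suc j))) (elems K X′))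
            ≡⟨ subst (λ k → ν (det B′ (elems K (initial m k)) (elems K X′)) ≡ real (F′ X′)) ∣X′∣≡1+j (hF′ X′) ⟩
          real (F′ X′) ∎

        bound : Row₀Bound X Y
        bound = subst (_≼_ _) (ℝ.solve 2 (λ a b → (a ℝ.:+ b) ℝ.:- b ℝ.:= a) refl (F (outside ∷ X)) (F′ X′))
          (≼-cancelˡ cofactor (subst (λ Z → det B (suc y₀ ∷ I ⁺) (X′ ⁺) * det B (zero ∷ Z ⁺) (X ⁺) ≼ β)
                                     (remove-insert Y y₀ y₀∉Y) Ψy₀-bound))

      Row₀BoundAtWeight : ℕ → ℕ → Set
      Row₀BoundAtWeight j w = ∀ X Y → weight Y ≡ w → ∣ Y ∣ ≡ j → ∣ X ∣ ≡ suc j → Row₀Bound X Y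

      row₀-bound : ∀ j X Y → ∣ Y ∣ ≡ j → ∣ X ∣ ≡ suc j → Row₀Bound X Y
      row₀-bound-step : ∀ j w → (∀ {w′} → w′ < w → Row₀BoundAtWeight j w′) → Row₀BoundAtWeight j w

      row₀-bound j X Y = <-rec (Row₀BoundAtWeight j) (row₀-bound-step j) (weight Y) X Y refl

      row₀-bound-step j _ _ X Y refl ∣Y∣≡j ∣X∣≡1+j with ⊆⊎∃∉ (initial m j) Y
      ... | inj₁ initial⊆Y = subst (Row₀Bound X) initial≡Y (topMinor-bound X j ∣X∣≡1+j)
        where
        initial≡Y : initial m j ≡ Y
        initial≡Y = p⊆q∧∣p∣≡∣q∣⇒p≡q initial⊆Y (trans (∣initial∣ (subst (_≤ℕ m) ∣Y∣≡j (∣p∣≤n Y))) (sym ∣Y∣≡j))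
      row₀-bound-step zero    _ _       X Y refl ∣Y∣≡j ∣X∣≡1+j | inj₂ (y₀ , y₀∈initial , _) =
        contradiction (∈-initial⁻ y₀∈initial) λ ()
      row₀-bound-step (suc j) _ lighter X Y refl ∣Y∣≡j ∣X∣≡1+j | inj₂ (y₀ , y₀∈initial , y₀∉Y) =
        Exchange.bound ∣Y∣≡j ∣X∣≡1+j y₀∈initial y₀∉Y (row₀-bound j)
                       (λ Y′ lt ∣Y′∣ → lighter lt X Y′ refl ∣Y′∣ ∣X∣≡1+j)

      bounded : BoundsMinors B F
      bounded (inside ∷ X)  (inside ∷ Y)  ∣S∣≡∣T∣ = subst₂ _≼_ (sym (det-cofactor₀₀ (elems K Y) (elems K X)))
        (ℝ.solve 2 (λ c a → c ℝ.:+ (a ℝ.:- c) ℝ.:= a) refl c (F (inside ∷ X)))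
        (≼-* (≼-reflexive ν-B₀₀) (IH X Y (ℕP.suc-injective ∣S∣≡∣T∣)))
      bounded (inside ∷ X)  (outside ∷ Y) ∣S∣≡∣T∣ =
        subst (_≼ F (inside ∷ X)) (sym (det-zeroColumn (elems K Y) _)) (0≼ _)
      bounded (outside ∷ X) (outside ∷ Y) ∣S∣≡∣T∣ =
        ≼-≤-trans (subst (_≼ F′ X) (sym (det-map B suc suc (elems K Y) (elems K X))) (IH X Y ∣S∣≡∣T∣)) (F′≤F X)
      bounded (outside ∷ X) (inside ∷ Y)  ∣S∣≡∣T∣ = row₀-bound ∣ Y ∣ X Y refl ∣S∣≡∣T∣

  minors-bounded : ∀ n (B : Matrix K n) → UpperTriangular K B → ∀ F →
    ValuesTopMinors B F → Submodular R F → BoundsMinors B F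
  minors-bounded zero    B ut F hF sub [] [] _ = ≼-reflexive (hF [])
  minors-bounded (suc m) B ut F hF sub = bounded (minors-bounded m B′ ut′ F′ hF′ sub′)
    where open InductionStep B ut F hF sub

lemma3p4 : (K : Field) (R : RealField) (v : Valuation K R) (n : ℕ)
    (B : Matrix K n) → UpperTriangular K B →
    Σ (Subset n → RealField.Carrier R)
      (λ F → (∀ S → Valuation.ν v (topMinor K B S) ≡ real (F S)) × Submodular R F) →
    ∀ (S T : Subset n) → ∣ S ∣ ≡ ∣ T ∣ →
    Valuation.ν v (minor K B T S) ≤⁻ Valuation.ν v (topMinor K B S)
lemma3p4 K R v n B ut (F , hF , sub) S T ∣S∣≡∣T∣ =
  subst₂ _≤⁻_ (cong ν (sym (minor≡det B S T ∣S∣≡∣T∣))) (sym (hF S))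
    (minors-bounded n B ut F (λ S → trans (cong ν (sym (topMinor≡det B S))) (hF S)) sub S T ∣S∣≡∣T∣)
  where
  open Valuation v using (ν)
  open Elements K using (minor≡det; topMinor≡det)
  open TopMinorBound K R v using (minors-bounded)
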